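{- Let $m,n$ be positive integers with $\gcd(m+1,n+1)>1$. Then the complete tripartite graph $K_{1,m,n}$ is not interval colorable, i.e. there is no positive integer $t$ for which $K_{1,m,n}$ has an interval $t$-coloring.
   Context: All graphs are finite, undirected, without loops or multiple edges. $K_{1,m,n}$ denotes the complete tripartite graph with parts of sizes $1$, $m$ and $n$. A proper edge-coloring of a graph $G$ with colors $1,\ldots,t$ is an interval $t$-coloring if all $t$ colors are used and, for every vertex $v$ of $G$, the set of colors of the edges incident to $v$ (which are pairwise distinct) forms an interval of consecutive integers. A graph is interval colorable if it has an interval $t$-coloring for some positive integer $t$. -}

module Defs where

open import Data.Nat using (ℕ; suc; _≤_; _+_)
import Data.Fin
open import Data.Fin using (Fin)
open import Data.Sum using (_⊎_; inj₁; inj₂)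
open import Data.Product using (_×_; Σ; ∃; ∃-syntax; _,_)
open import Data.Empty using (⊥)
open import Data.Unit using (⊤)
open import Relation.Binary.PropositionalEquality using (_≡_)
open import Relation.Nullary using (¬_)

record Graph : Set₁ where
  field
    N     : ℕ
    Adj   : Fin N → Fin N → Set
    sym   : ∀ {u v} → Adj u v → Adj v u
    irrefl : ∀ {u} → ¬ Adj u u

-- An edge coloring assigns a color to every edge uv; it is given as a function
-- on adjacent ordered pairs that agrees on both orientations (and on all
-- adjacency proofs), i.e. a function on (unordered) edges.
record IntervalColoring (G : Graph) (t : ℕ) : Set where
  open Graph G
  field
    col      : (u v : Fin N) → Adj u v → ℕ
    col-edge : ∀ u v (e : Adj u v) (e′ : Adj v u) → col u v e ≡ col v u e′
    col-range : ∀ u v (e : Adj u v) → 1 ≤ col u v e × col u v e ≤ t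
    proper   : ∀ v w w′ (e : Adj v w) (e′ : Adj v w′) →
               col v w e ≡ col v w′ e′ → w ≡ w′
    surj     : ∀ c → 1 ≤ c → c ≤ t → ∃[ u ] ∃[ v ] Σ (Adj u v) λ e → col u v e ≡ c
    interval : ∀ v w w′ (e : Adj v w) (e′ : Adj v w′) c →
               col v w e ≤ c → c ≤ col v w′ e′ →
               ∃[ x ] Σ (Adj v x) λ f → col v x f ≡ c

IntervalColorable : Graph → Set
IntervalColorable G = ∃[ t ] (1 ≤ t × IntervalColoring G t)

-- Complete tripartite graph K_{1,m,n}: vertices Fin (1 + m + n),
-- parts 0 = {0}, 1 = {1..m}, 2 = {m+1..m+n}.
data Part : Set where
  p0 p1 p2 : Part

part : ∀ m n → Fin (1 + m + n) → Part
part m n i with Data.Fin.splitAt (1 + m) i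
... | inj₂ _ = p2
... | inj₁ j with Data.Fin.splitAt 1 j
...   | inj₁ _ = p0
...   | inj₂ _ = p1

_≢ₚ_ : Part → Part → Set
p0 ≢ₚ p0 = ⊥
p1 ≢ₚ p1 = ⊥
p2 ≢ₚ p2 = ⊥
_  ≢ₚ _  = ⊤

≢ₚ-sym : ∀ {a b} → a ≢ₚ b → b ≢ₚ a
≢ₚ-sym {p0} {p1} _ = _
≢ₚ-sym {p0} {p2} _ = _
≢ₚ-sym {p1} {p0} _ = _
≢ₚ-sym {p1} {p2} _ = _
≢ₚ-sym {p2} {p0} _ = _
≢ₚ-sym {p2} {p1} _ = _

≢ₚ-irr : ∀ {a} → ¬ (a ≢ₚ a)
≢ₚ-irr {p0} ()
≢ₚ-irr {p1} ()
≢ₚ-irr {p2} ()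

K1 : ℕ → ℕ → Graph
K1 m n = record
  { N = 1 + m + n
  ; Adj = λ u v → part m n u ≢ₚ part m n v
  ; sym = ≢ₚ-sym
  ; irrefl = ≢ₚ-irr
  }

-- Let d > 1 divide both m + 1 = αd and n + 1 = βd, and let f be the indicator of the colours
-- in a fixed residue class modulo d. In an interval colouring the colours at a vertex v are
-- exactly an interval of length deg v, so when d ∣ deg v the colours at v contain exactly
-- deg v / d members of the class: β at each vertex of the part of size m (degree n + 1) and
-- α at each vertex of the part of size n (degree m + 1). The centre has degree
-- m + n = (α + β)d − 2; choosing the class so that of the two colours just above the centre's
-- interval the lower is outside and the upper inside it, the centre sees α + β − 1 of them.
-- Summing over all vertices counts every edge of the class twice, yet the total is
-- α + β − 1 + mβ + nα = 2αβd − 1, which is odd.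
module Submission where

open import Data.Bool using (if_then_else_)
open import Data.Empty using (⊥-elim)
open import Data.Fin using (Fin; zero; suc; _↑ˡ_; _↑ʳ_; fromℕ<)
open import Data.Fin.Properties using (splitAt-↑ˡ; splitAt-↑ʳ) renaming (_≟_ to _≟ᶠ_)
open import Data.List using (List; filter; allFin)
import Data.List.Extrema
open import Data.List.Membership.Propositional using (_∈_)
open import Data.List.Membership.Propositional.Properties using (∈-filter⁺; ∈-allFin)
open import Data.List.Relation.Unary.All as All using (All)
open import Data.List.Relation.Unary.All.Properties using (all-filter)
open import Data.Nat using (ℕ; zero; suc; _+_; _*_; _∸_; _≤_; _<_; s≤s; z≤n; NonZero)
open import Data.Nat.Divisibility
  using (_∣_; _∣?_; divides; ∣m∣n⇒∣m+n; ∣m+n∣m⇒∣n; m∣m*n; ∣-refl; ∣⇒≤; ∣1⇒≡1)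
open import Data.Nat.GCD using (gcd; gcd[m,n]∣m; gcd[m,n]∣n)
open import Data.Nat.Properties
open import Algebra.Properties.CommutativeMonoid.Sum +-0-commutativeMonoid
  using (sum-syntax; ∑-distrib-+; sum-cong-≗)
open import Data.Nat.Tactic.RingSolver using (solve-∀)
open import Algebra.Properties.CommutativeSemigroup +-commutativeSemigroup using (xy∙z≈xz∙y)
open import Data.Product using (_×_; _,_; ∃-syntax; proj₁; proj₂)
open import Data.Sum using (_⊎_; [_,_]′)
open import Data.Unit using (tt)
open import Defs
open import Level using (Level)
open import Relation.Binary.PropositionalEquality
open import Relation.Nullary using (Dec; yes; no; does; ¬_)
open import Relation.Nullary.Decidable using (dec-true; dec-false; _×-dec_)

infixr 11 [_]·_

[_]·_ : ∀ {p} {P : Set p} → Dec P → ℕ → ℕ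
[ P? ]· n = if does P? then n else 0

private
  variable
    p q r : Level
    P : Set p
    Q : Set q
    R : Set r
    n : ℕ

[]·-yes : (P? : Dec P) → P → [ P? ]· n ≡ n
[]·-yes P? x rewrite dec-true P? x = refl

[]·-no : (P? : Dec P) → ¬ P → [ P? ]· n ≡ 0
[]·-no P? ¬x rewrite dec-false P? ¬x = refl

[]·-cong : (P? : Dec P) (Q? : Dec Q) → (P → Q) → (Q → P) → [ P? ]· n ≡ [ Q? ]· n
[]·-cong P? (yes q) _   Q→P = []·-yes P? (Q→P q)
[]·-cong P? (no ¬q) P→Q _   = []·-no P? (λ p → ¬q (P→Q p))

[]·-⊎ : (P? : Dec P) (Q? : Dec Q) (R? : Dec R) →
        (P → Q ⊎ R) → (Q → P) → (R → P) → (Q → ¬ R) → [ P? ]· n ≡ [ Q? ]· n + [ R? ]· n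
[]·-⊎ {n = n} P? (yes q) R? _ Q→P _ Q→¬R =
  trans ([]·-yes P? (Q→P q)) (sym (trans (cong (n +_) ([]·-no R? (Q→¬R q))) (+-identityʳ n)))
[]·-⊎ P? (no ¬q) (yes r) _ _ R→P _ = []·-yes P? (R→P r)
[]·-⊎ P? (no ¬q) (no ¬r) P→Q⊎R _ _ _ = []·-no P? λ p → [ ¬q , ¬r ]′ (P→Q⊎R p)

∑-const : ∀ n a → ∑[ i < n ] a ≡ n * a
∑-const zero    a = refl
∑-const (suc n) a = cong (a +_) (∑-const n a)

∑-↑ : ∀ a b (f : Fin (a + b) → ℕ) →
      ∑[ i < a + b ] f i ≡ ∑[ i < a ] f (i ↑ˡ b) + ∑[ j < b ] f (a ↑ʳ j)
∑-↑ zero    b f = refl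
∑-↑ (suc a) b f = trans (cong (f zero +_) (∑-↑ a b (λ i → f (suc i)))) (sym (+-assoc (f zero) _ _))

∑-zero : ∀ {N} {f : Fin N → ℕ} → (∀ i → f i ≡ 0) → ∑[ i < N ] f i ≡ 0
∑-zero {N} f≡0 = trans (sum-cong-≗ f≡0) (trans (∑-const N 0) (*-zeroʳ N))

∑-single : ∀ {N} (g : Fin N → ℕ) (w : Fin N) → ∑[ v < N ] [ v ≟ᶠ w ]· g v ≡ g w
∑-single {suc N} g zero = trans (cong (g zero +_) (∑-zero {N} (λ _ → refl))) (+-identityʳ (g zero))
∑-single {suc N} g (suc w) = ∑-single (λ v → g (suc v)) w

handshake : ∀ {N} (h : Fin N → Fin N → ℕ) → (∀ u v → h u v ≡ h v u) → (∀ v → h v v ≡ 0) →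
            2 ∣ ∑[ u < N ] ∑[ v < N ] h u v
handshake {zero}  h h-sym h-diag = divides 0 refl
handshake {suc N} h h-sym h-diag =
  subst (2 ∣_) (sym total)
        (∣m∣n⇒∣m+n (m∣m*n A)
                   (handshake (λ u v → h (suc u) (suc v)) (λ u v → h-sym (suc u) (suc v)) (λ v → h-diag (suc v))))
  where
  A rest : ℕ
  A = ∑[ v < N ] h zero (suc v)
  rest = ∑[ u < N ] ∑[ v < N ] h (suc u) (suc v)
  total : ∑[ u < suc N ] ∑[ v < suc N ] h u v ≡ 2 * A + rest
  total = begin
    (h zero zero + A) + ∑[ u < N ] (h (suc u) zero + ∑[ v < N ] h (suc u) (suc v))
      ≡⟨ cong₂ _+_ (cong (_+ A) (h-diag zero))
                   (∑-distrib-+ (λ u → h (suc u) zero) (λ u → ∑[ v < N ] h (suc u) (suc v))) ⟩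
    A + (∑[ u < N ] h (suc u) zero + rest)
      ≡⟨ cong (λ B → A + (B + rest)) (sum-cong-≗ (λ u → h-sym (suc u) zero)) ⟩
    A + (A + rest)
      ≡⟨ sym (+-assoc A A rest) ⟩
    A + A + rest
      ≡⟨ cong (λ B → A + B + rest) (sym (+-identityʳ A)) ⟩
    2 * A + rest ∎
    where open ≡-Reasoning

∑< : ℕ → (ℕ → ℕ) → ℕ
∑< zero    F = 0
∑< (suc k) F = ∑< k F + F k

∑<-cong : ∀ k {F G : ℕ → ℕ} → (∀ i → F i ≡ G i) → ∑< k F ≡ ∑< k G
∑<-cong zero    F≡G = refl
∑<-cong (suc k) F≡G = cong₂ _+_ (∑<-cong k F≡G) (F≡G k)

∑<-zero : ∀ k {F : ℕ → ℕ} → (∀ i → i < k → F i ≡ 0) → ∑< k F ≡ 0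
∑<-zero zero    F≡0 = refl
∑<-zero (suc k) F≡0 = cong₂ _+_ (∑<-zero k (λ i i<k → F≡0 i (m<n⇒m<1+n i<k))) (F≡0 k (n<1+n k))

∑<-ones : ∀ k → ∑< k (λ _ → 1) ≡ k
∑<-ones zero    = refl
∑<-ones (suc k) = trans (cong (_+ 1) (∑<-ones k)) (+-comm k 1)

∑<-+ : ∀ a b (F : ℕ → ℕ) → ∑< (a + b) F ≡ ∑< a F + ∑< b (λ i → F (a + i))
∑<-+ a zero    F = trans (cong (λ k → ∑< k F) (+-identityʳ a)) (sym (+-identityʳ _))
∑<-+ a (suc b) F = begin
  ∑< (a + suc b) F                         ≡⟨ cong (λ k → ∑< k F) (+-suc a b) ⟩
  ∑< (a + b) F + F (a + b)                 ≡⟨ cong (_+ F (a + b)) (∑<-+ a b F) ⟩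
  ∑< a F + ∑< b (λ i → F (a + i)) + F (a + b) ≡⟨ +-assoc (∑< a F) _ _ ⟩
  ∑< a F + ∑< (suc b) (λ i → F (a + i))     ∎
  where open ≡-Reasoning

∑<-shift : ∀ k (F : ℕ → ℕ) → ∑< k (λ i → F (suc i)) + F 0 ≡ ∑< k F + F k
∑<-shift zero    F = refl
∑<-shift (suc k) F = begin
  ∑< k (λ i → F (suc i)) + F (suc k) + F 0 ≡⟨ xy∙z≈xz∙y _ (F (suc k)) (F 0) ⟩
  ∑< k (λ i → F (suc i)) + F 0 + F (suc k) ≡⟨ cong (_+ F (suc k)) (∑<-shift k F) ⟩
  ∑< k F + F k + F (suc k)                 ∎
  where open ≡-Reasoning

module _ {d : ℕ} {F : ℕ → ℕ} (F-periodic : ∀ x → F (x + d) ≡ F x) where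

  ∑<-window : ∀ b → ∑< d (λ i → F (b + i)) ≡ ∑< d F
  ∑<-window zero    = refl
  ∑<-window (suc b) = +-cancelʳ-≡ (F b) _ _ (begin
    ∑< d (λ i → F (suc b + i)) + F b
      ≡⟨ cong₂ _+_ (∑<-cong d (λ i → cong F (sym (+-suc b i)))) (cong F (sym (+-identityʳ b))) ⟩
    ∑< d (λ i → F (b + suc i)) + F (b + 0)
      ≡⟨ ∑<-shift d (λ i → F (b + i)) ⟩
    ∑< d (λ i → F (b + i)) + F (b + d)
      ≡⟨ cong₂ _+_ (∑<-window b) (F-periodic b) ⟩
    ∑< d F + F b ∎)
    where open ≡-Reasoning

  ∑<-windows : ∀ j b → ∑< (j * d) (λ i → F (b + i)) ≡ j * ∑< d F
  ∑<-windows zero    b = refl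
  ∑<-windows (suc j) b = begin
    ∑< (d + j * d) (λ i → F (b + i))
      ≡⟨ ∑<-+ d (j * d) _ ⟩
    ∑< d (λ i → F (b + i)) + ∑< (j * d) (λ i → F (b + (d + i)))
      ≡⟨ cong₂ _+_ (∑<-window b) (∑<-cong (j * d) (λ i → cong F (sym (+-assoc b d i)))) ⟩
    ∑< d F + ∑< (j * d) (λ i → F (b + d + i))
      ≡⟨ cong (∑< d F +_) (∑<-windows j (b + d)) ⟩
    ∑< d F + j * ∑< d F ∎
    where open ≡-Reasoning

multiples-below : ∀ d .{{_ : NonZero d}} → ∑< d (λ i → [ d ∣? i ]· 1) ≡ 1
multiples-below (suc d′) = trans (sym (∑<-shift d′ (λ i → [ suc d′ ∣? i ]· 1)))
  (cong₂ _+_ (∑<-zero d′ λ i i<d′ → []·-no (suc d′ ∣? suc i) λ d∣1+i → <⇒≱ (s≤s i<d′) (∣⇒≤ d∣1+i))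
             ([]·-yes (suc d′ ∣? 0) (divides 0 refl)))

multiples-periodic : ∀ d x → [ d ∣? x + d ]· 1 ≡ [ d ∣? x ]· 1
multiples-periodic d x = []·-cong (d ∣? x + d) (d ∣? x)
  (λ d∣x+d → ∣m+n∣m⇒∣n (subst (d ∣_) (+-comm x d) d∣x+d) ∣-refl)
  (λ d∣x → ∣m∣n⇒∣m+n d∣x ∣-refl)

multiples-in-window : ∀ d .{{_ : NonZero d}} j b → ∑< (j * d) (λ i → [ d ∣? b + i ]· 1) ≡ j
multiples-in-window d j b = begin
  ∑< (j * d) (λ i → [ d ∣? b + i ]· 1) ≡⟨ ∑<-windows (multiples-periodic d) j b ⟩
  j * ∑< d (λ i → [ d ∣? i ]· 1)       ≡⟨ cong (j *_) (multiples-below d) ⟩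
  j * 1                                ≡⟨ *-identityʳ j ⟩
  j                                    ∎
  where open ≡-Reasoning

∣suc⇒∤ : ∀ {d x} → 1 < d → d ∣ suc x → ¬ d ∣ x
∣suc⇒∤ {d} {x} 1<d d∣1+x d∣x =
  <-irrefl (sym (∣1⇒≡1 (∣m+n∣m⇒∣n (subst (d ∣_) (+-comm 1 x) d∣1+x) d∣x))) 1<d

module _ {N p} {P : Fin N → Set p} (P? : ∀ w → Dec (P w)) (x : Fin N → ℕ)
         (x-injective : ∀ {u w} → P u → P w → x u ≡ x w → u ≡ w)
         (lo : ℕ) (lo≤x : ∀ {w} → P w → lo ≤ x w) where

  private
    Below At : ℕ → Fin N → Set p
    Below k w = P w × x w < lo + k
    At    k w = P w × x w ≡ lo + k

    below? : ∀ k w → Dec (Below k w)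
    below? k w = P? w ×-dec x w <? lo + k

    at? : ∀ k w → Dec (At k w)
    at? k w = P? w ×-dec x w ≟ lo + k

    below-suc : ∀ k w n → [ below? (suc k) w ]· n ≡ [ below? k w ]· n + [ at? k w ]· n
    below-suc k w n = []·-⊎ (below? (suc k) w) (below? k w) (at? k w)
      (λ (Pw , x<) → Data.Sum.map (Pw ,_) (Pw ,_) (m<1+n⇒m<n∨m≡n (subst (x w <_) (+-suc lo k) x<)))
      (λ (Pw , x<) → Pw , subst (x w <_) (sym (+-suc lo k)) (m<n⇒m<1+n x<))
      (λ (Pw , x≡) → Pw , subst (x w <_) (sym (+-suc lo k)) (≤-reflexive (cong suc x≡)))
      (λ (_ , x<) (_ , x≡) → <⇒≢ x< x≡)

    ∑-at : ∀ {k w₀} → At k w₀ → (F : ℕ → ℕ) → ∑[ w < N ] [ at? k w ]· F (x w) ≡ F (lo + k)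
    ∑-at {k} {w₀} (Pw₀ , xw₀≡) F = begin
      ∑[ w < N ] [ at? k w ]· F (x w)  ≡⟨ sum-cong-≗ (λ w → []·-cong (at? k w) (w ≟ᶠ w₀)
                                            (λ (Pw , xw≡) → x-injective Pw Pw₀ (trans xw≡ (sym xw₀≡)))
                                            (λ { refl → Pw₀ , xw₀≡ })) ⟩
      ∑[ w < N ] [ w ≟ᶠ w₀ ]· F (x w)  ≡⟨ ∑-single (λ w → F (x w)) w₀ ⟩
      F (x w₀)                         ≡⟨ cong F xw₀≡ ⟩
      F (lo + k)                       ∎
      where open ≡-Reasoning

    -- Raising the cut-off from lo + k to lo + k + 1 adds exactly the w with x w = lo + k,
    -- which is unique by injectivity.
    ∑-below : ∀ k → (∀ i → i < k → ∃[ w ] At i w) → (F : ℕ → ℕ) →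
              ∑[ w < N ] [ below? k w ]· F (x w) ≡ ∑< k (λ i → F (lo + i))
    ∑-below zero _ F = ∑-zero (λ w → []·-no (below? 0 w)
      λ (Pw , x<lo+0) → <⇒≱ (subst (x w <_) (+-identityʳ lo) x<lo+0) (lo≤x Pw))
    ∑-below (suc k) hit F = begin
      ∑[ w < N ] [ below? (suc k) w ]· F (x w)
        ≡⟨ sum-cong-≗ (λ w → below-suc k w (F (x w))) ⟩
      ∑[ w < N ] ([ below? k w ]· F (x w) + [ at? k w ]· F (x w))
        ≡⟨ ∑-distrib-+ (λ w → [ below? k w ]· F (x w)) (λ w → [ at? k w ]· F (x w)) ⟩
      ∑[ w < N ] [ below? k w ]· F (x w) + ∑[ w < N ] [ at? k w ]· F (x w)
        ≡⟨ cong₂ _+_ (∑-below k (λ i i<k → hit i (m<n⇒m<1+n i<k)) F)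
                     (∑-at (proj₂ (hit k (n<1+n k))) F) ⟩
      ∑< k (λ i → F (lo + i)) + F (lo + k) ∎
      where open ≡-Reasoning

  ∑-reindex-interval : ∀ k → (∀ {w} → P w → x w < lo + k) →
                       (∀ i → i < k → ∃[ w ] P w × x w ≡ lo + i) → (F : ℕ → ℕ) →
                       ∑[ w < N ] [ P? w ]· F (x w) ≡ ∑< k (λ i → F (lo + i))
  ∑-reindex-interval k x<lo+k hit F =
    trans (sum-cong-≗ (λ w → []·-cong (P? w) (below? k w) (λ Pw → Pw , x<lo+k Pw) proj₁))
          (∑-below k hit F)

module ColouredGraph (G : Graph) (adj? : ∀ u v → Dec (Graph.Adj G u v))
                     {t : ℕ} (φ : IntervalColoring G t) where
  open Graph G renaming (sym to Adj-sym)
  open IntervalColoring φ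

  col-irrelevant : ∀ {u v} (e e′ : Adj u v) → col u v e ≡ col u v e′
  col-irrelevant {u} {v} e e′ = trans (col-edge u v e (Adj-sym e)) (sym (col-edge u v e′ (Adj-sym e)))

  -- 0 is a junk value on non-edges: colour u v is only ever used under the guard [ adj? u v ]·.
  colour : Fin N → Fin N → ℕ
  colour u v with adj? u v
  ... | yes e = col u v e
  ... | no _  = 0

  colour≡col : ∀ {u v} (e : Adj u v) → colour u v ≡ col u v e
  colour≡col {u} {v} e with adj? u v
  ... | yes e′ = col-irrelevant e′ e
  ... | no ¬e  = ⊥-elim (¬e e)

  colour-sym : ∀ u v → colour u v ≡ colour v u
  colour-sym u v with adj? u v | adj? v u
  ... | yes e | yes e′ = col-edge u v e e′
  ... | yes e | no ¬e′ = ⊥-elim (¬e′ (Adj-sym e))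
  ... | no ¬e | yes e′ = ⊥-elim (¬e (Adj-sym e′))
  ... | no _  | no _   = refl

  ∑-at : Fin N → (ℕ → ℕ) → ℕ
  ∑-at v F = ∑[ w < N ] [ adj? v w ]· F (colour v w)

  degree : Fin N → ℕ
  degree v = ∑-at v (λ _ → 1)

  ∑-at-even : ∀ F → 2 ∣ ∑[ v < N ] ∑-at v F
  ∑-at-even F = handshake (λ v w → [ adj? v w ]· F (colour v w))
    (λ v w → trans ([]·-cong (adj? v w) (adj? w v) Adj-sym Adj-sym)
                   (cong (λ c → [ adj? w v ]· F c) (colour-sym v w)))
    (λ v → []·-no (adj? v v) irrefl)

  ColoursFormInterval : Fin N → ℕ → Set
  ColoursFormInterval v k = ∃[ lo ] ∀ F → ∑-at v F ≡ ∑< k (λ i → F (lo + i))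

  neighbours : Fin N → List (Fin N)
  neighbours v = filter (adj? v) (allFin N)

  ∈-neighbours : ∀ {v w} → Adj v w → w ∈ neighbours v
  ∈-neighbours {v} {w} v~w = ∈-filter⁺ (adj? v) (∈-allFin w) v~w

  module _ (v : Fin N) {w₀ : Fin N} (v~w₀ : Adj v w₀) where
    open Data.List.Extrema ≤-totalOrder

    least-colour : ∃[ wₗ ] Adj v wₗ × (∀ {w} → Adj v w → colour v wₗ ≤ colour v w)
    least-colour = argmin (colour v) w₀ (neighbours v)
                 , argmin-all (colour v) v~w₀ (all-filter (adj? v) (allFin N))
                 , λ v~w → All.lookup (f[argmin]≤f[xs] {f = colour v} w₀ (neighbours v)) (∈-neighbours v~w)

    greatest-colour : ∃[ wₕ ] Adj v wₕ × (∀ {w} → Adj v w → colour v w ≤ colour v wₕ)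
    greatest-colour = argmax (colour v) w₀ (neighbours v)
                    , argmax-all (colour v) v~w₀ (all-filter (adj? v) (allFin N))
                    , λ v~w → All.lookup (f[xs]≤f[argmax] {f = colour v} w₀ (neighbours v)) (∈-neighbours v~w)

  interval-between-extremes :
    ∀ v {wₗ wₕ} → Adj v wₗ → Adj v wₕ →
    (∀ {w} → Adj v w → colour v wₗ ≤ colour v w) → (∀ {w} → Adj v w → colour v w ≤ colour v wₕ) →
    ColoursFormInterval v (degree v)
  interval-between-extremes v {wₗ} {wₕ} v~wₗ v~wₕ lo≤ ≤hi =
    lo , λ F → trans (∑-colours F) (cong (λ k → ∑< k (λ i → F (lo + i))) k≡degree)
    where
    lo hi k : ℕ
    lo = colour v wₗ
    hi = colour v wₕ
    k = suc (hi ∸ lo)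

    lo+k≡1+hi : lo + k ≡ suc hi
    lo+k≡1+hi = trans (+-suc lo (hi ∸ lo)) (cong suc (m+[n∸m]≡n (lo≤ v~wₕ)))

    injective : ∀ {u w} → Adj v u → Adj v w → colour v u ≡ colour v w → u ≡ w
    injective v~u v~w eq = proper v _ _ v~u v~w (trans (sym (colour≡col v~u)) (trans eq (colour≡col v~w)))

    below : ∀ {w} → Adj v w → colour v w < lo + k
    below {w} v~w = subst (colour v w <_) (sym lo+k≡1+hi) (s≤s (≤hi v~w))

    hit : ∀ i → i < k → ∃[ w ] Adj v w × colour v w ≡ lo + i
    hit i i<k with interval v wₗ wₕ v~wₗ v~wₕ (lo + i)
                    (subst (_≤ lo + i) (colour≡col v~wₗ) (m≤m+n lo i))
                    (subst (lo + i ≤_) (colour≡col v~wₕ)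
                           (≤-pred (subst (lo + i <_) lo+k≡1+hi (+-monoʳ-< lo i<k))))
    ... | w , v~w , col≡ = w , v~w , trans (colour≡col v~w) col≡

    ∑-colours : ∀ F → ∑-at v F ≡ ∑< k (λ i → F (lo + i))
    ∑-colours = ∑-reindex-interval (adj? v) (colour v) injective lo lo≤ k below hit

    k≡degree : k ≡ degree v
    k≡degree = trans (sym (∑<-ones k)) (sym (∑-colours (λ _ → 1)))

  colours-form-interval : ∀ v {w} → Adj v w → ColoursFormInterval v (degree v)
  colours-form-interval v v~w with least-colour v v~w | greatest-colour v v~w
  ... | wₗ , v~wₗ , lo≤ | wₕ , v~wₕ , ≤hi = interval-between-extremes v v~wₗ v~wₕ lo≤ ≤hi

_≢ₚ?_ : (a b : Part) → Dec (a ≢ₚ b)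
p0 ≢ₚ? p0 = no λ ()
p0 ≢ₚ? p1 = yes tt
p0 ≢ₚ? p2 = yes tt
p1 ≢ₚ? p0 = yes tt
p1 ≢ₚ? p1 = no λ ()
p1 ≢ₚ? p2 = yes tt
p2 ≢ₚ? p0 = yes tt
p2 ≢ₚ? p1 = yes tt
p2 ≢ₚ? p2 = no λ ()

part-↑ˡ : ∀ m n (j : Fin m) → part m n (suc j ↑ˡ n) ≡ p1
part-↑ˡ m n j rewrite splitAt-↑ˡ m j n = refl

part-↑ʳ : ∀ m n (j : Fin n) → part m n (suc m ↑ʳ j) ≡ p2
part-↑ʳ m n j rewrite splitAt-↑ʳ (suc m) n j = refl

∑-K1 : ∀ m n {a b} (X : Fin (1 + m + n) → ℕ) →
       (∀ j → X (suc j ↑ˡ n) ≡ a) → (∀ j → X (suc m ↑ʳ j) ≡ b) →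
       ∑[ v < 1 + m + n ] X v ≡ X zero + (m * a + n * b)
∑-K1 m n {a} {b} X X≡a X≡b = begin
  ∑[ v < 1 + m + n ] X v                                           ≡⟨ ∑-↑ (suc m) n X ⟩
  X zero + ∑[ j < m ] X (suc j ↑ˡ n) + ∑[ j < n ] X (suc m ↑ʳ j)   ≡⟨ +-assoc (X zero) _ _ ⟩
  X zero + (∑[ j < m ] X (suc j ↑ˡ n) + ∑[ j < n ] X (suc m ↑ʳ j))
    ≡⟨ cong (X zero +_) (cong₂ _+_ (trans (sum-cong-≗ X≡a) (∑-const m a))
                                   (trans (sum-cong-≗ X≡b) (∑-const n b))) ⟩
  X zero + (m * a + n * b)                                         ∎
  where open ≡-Reasoning

module K1Colouring (m n : ℕ) {t : ℕ} (φ : IntervalColoring (K1 m n) t) where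
  open ColouredGraph (K1 m n) (λ u v → part m n u ≢ₚ? part m n v) φ public

  partDegree : Part → ℕ
  partDegree p = [ p ≢ₚ? p0 ]· 1 + (m * [ p ≢ₚ? p1 ]· 1 + n * [ p ≢ₚ? p2 ]· 1)

  degree≡partDegree : ∀ v → degree v ≡ partDegree (part m n v)
  degree≡partDegree v = ∑-K1 m n (λ w → [ part m n v ≢ₚ? part m n w ]· 1)
    (λ j → cong (λ p → [ part m n v ≢ₚ? p ]· 1) (part-↑ˡ m n j))
    (λ j → cong (λ p → [ part m n v ≢ₚ? p ]· 1) (part-↑ʳ m n j))

  interval-centre : 1 ≤ m → ColoursFormInterval zero (m + n)
  interval-centre 1≤m =
    subst (ColoursFormInterval zero)
          (trans (degree≡partDegree zero) (cong₂ _+_ (*-identityʳ m) (*-identityʳ n)))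
          (colours-form-interval zero {suc j₀ ↑ˡ n} (subst (p0 ≢ₚ_) (sym (part-↑ˡ m n j₀)) tt))
    where
    j₀ : Fin m
    j₀ = fromℕ< 1≤m

  interval-↑ˡ : ∀ j → ColoursFormInterval (suc j ↑ˡ n) (suc n)
  interval-↑ˡ j =
    subst (ColoursFormInterval (suc j ↑ˡ n))
          (trans (degree≡partDegree (suc j ↑ˡ n)) (trans (cong partDegree (part-↑ˡ m n j))
                 (cong suc (cong₂ _+_ (*-zeroʳ m) (*-identityʳ n)))))
          (colours-form-interval (suc j ↑ˡ n) {zero} (subst (_≢ₚ p0) (sym (part-↑ˡ m n j)) tt))

  interval-↑ʳ : ∀ j → ColoursFormInterval (suc m ↑ʳ j) (suc m)
  interval-↑ʳ j =
    subst (ColoursFormInterval (suc m ↑ʳ j))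
          (trans (degree≡partDegree (suc m ↑ʳ j)) (trans (cong partDegree (part-↑ʳ m n j))
                 (cong suc (trans (cong₂ _+_ (*-identityʳ m) (*-zeroʳ n)) (+-identityʳ m)))))
          (colours-form-interval (suc m ↑ʳ j) {zero} (subst (_≢ₚ p0) (sym (part-↑ʳ m n j)) tt))

module ResidueCount (m n d′ α β : ℕ) (1<d : 1 < suc d′)
                    (1+m≡αd : suc m ≡ α * suc d′) (1+n≡βd : suc n ≡ β * suc d′)
                    (1≤m : 1 ≤ m) {t : ℕ} (φ : IntervalColoring (K1 m n) t) where
  open K1Colouring m n φ public

  d : ℕ
  d = suc d′

  lo₀ : ℕ
  lo₀ = proj₁ (interval-centre 1≤m)

  -- f is the indicator of a residue class mod d, shifted by K so that of the two colours just above
  -- the centre's interval, lo₀ + (m + n) and lo₀ + (m + n + 1), only the second is counted.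
  K : ℕ
  K = d′ * (lo₀ + suc (m + n))

  f : ℕ → ℕ
  f c = [ d ∣? K + c ]· 1

  ∑<-f : ∀ lo j → ∑< (j * d) (λ i → f (lo + i)) ≡ j
  ∑<-f lo j = trans (∑<-cong (j * d) (λ i → cong (λ c → [ d ∣? c ]· 1) (sym (+-assoc K lo i))))
                    (multiples-in-window d j (K + lo))

  ∑-at-f : ∀ v j → ColoursFormInterval v (j * d) → ∑-at v f ≡ j
  ∑-at-f v j (lo , ∑-at≡) = trans (∑-at≡ f) (∑<-f lo j)

  top-multiple : d ∣ K + (lo₀ + suc (m + n))
  top-multiple = subst (d ∣_) (+-comm (lo₀ + suc (m + n)) K) (m∣m*n (lo₀ + suc (m + n)))

  f-top : f (lo₀ + suc (m + n)) ≡ 1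
  f-top = []·-yes (d ∣? _) top-multiple

  f-below-top : f (lo₀ + (m + n)) ≡ 0
  f-below-top = []·-no (d ∣? _)
    (∣suc⇒∤ 1<d (subst (d ∣_) (trans (cong (K +_) (+-suc lo₀ (m + n))) (+-suc K _)) top-multiple))

  ∑-at-centre : ∑-at zero f + 1 ≡ α + β
  ∑-at-centre = begin
    ∑-at zero f + 1                     ≡⟨ cong (_+ 1) (proj₂ (interval-centre 1≤m) f) ⟩
    ∑< (m + n) G + 1                    ≡⟨ cong₂ _+_ (sym (trans (cong (∑< (m + n) G +_) f-below-top)
                                                                 (+-identityʳ _)))
                                                     (sym f-top) ⟩
    ∑< (suc (suc (m + n))) G            ≡⟨ cong (λ k → ∑< k G) size ⟩
    ∑< ((α + β) * d) G                  ≡⟨ ∑<-f lo₀ (α + β) ⟩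
    α + β                               ∎
    where
    open ≡-Reasoning
    G : ℕ → ℕ
    G i = f (lo₀ + i)
    size : suc (suc (m + n)) ≡ (α + β) * d
    size = trans (cong suc (sym (+-suc m n)))
                 (trans (cong₂ _+_ 1+m≡αd 1+n≡βd) (sym (*-distribʳ-+ d α β)))

  ∑-at-↑ˡ : ∀ j → ∑-at (suc j ↑ˡ n) f ≡ β
  ∑-at-↑ˡ j = ∑-at-f (suc j ↑ˡ n) β (subst (ColoursFormInterval (suc j ↑ˡ n)) 1+n≡βd (interval-↑ˡ j))

  ∑-at-↑ʳ : ∀ j → ∑-at (suc m ↑ʳ j) f ≡ α
  ∑-at-↑ʳ j = ∑-at-f (suc m ↑ʳ j) α (subst (ColoursFormInterval (suc m ↑ʳ j)) 1+m≡αd (interval-↑ʳ j))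

  ∑-f-odd : suc (∑[ v < 1 + m + n ] ∑-at v f) ≡ 2 * (α * β * d)
  ∑-f-odd = begin
    suc (∑[ v < 1 + m + n ] ∑-at v f)   ≡⟨ cong suc (∑-K1 m n (λ v → ∑-at v f) ∑-at-↑ˡ ∑-at-↑ʳ) ⟩
    suc (∑-at zero f + (m * β + n * α)) ≡⟨ suc-+ (∑-at zero f) _ ⟩
    ∑-at zero f + 1 + (m * β + n * α)   ≡⟨ cong (_+ (m * β + n * α)) ∑-at-centre ⟩
    α + β + (m * β + n * α)             ≡⟨ regroup α β m n ⟩
    suc m * β + suc n * α               ≡⟨ cong₂ (λ a b → a * β + b * α) 1+m≡αd 1+n≡βd ⟩
    α * d * β + β * d * α               ≡⟨ double α β d ⟩
    2 * (α * β * d)                     ∎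
    where
    open ≡-Reasoning
    suc-+ : ∀ a b → suc (a + b) ≡ a + 1 + b
    suc-+ = solve-∀
    regroup : ∀ α β m n → α + β + (m * β + n * α) ≡ suc m * β + suc n * α
    regroup = solve-∀
    double : ∀ α β d → α * d * β + β * d * α ≡ 2 * (α * β * d)
    double = solve-∀

no-interval-colouring : ∀ {m n d t} → 1 ≤ m → 1 < d → d ∣ m + 1 → d ∣ n + 1 →
                        ¬ IntervalColoring (K1 m n) t
no-interval-colouring {m} {n} {suc d′} 1≤m 1<d (divides α m+1≡αd) (divides β n+1≡βd) φ =
  ∣suc⇒∤ (s≤s (s≤s z≤n)) (subst (2 ∣_) (sym ∑-f-odd) (m∣m*n (α * β * d))) (∑-at-even f)
  where
  open ResidueCount m n d′ α β 1<d (trans (+-comm 1 m) m+1≡αd) (trans (+-comm 1 n) n+1≡βd) 1≤m φ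

mainTheorem2 : ∀ (m n : ℕ) → 1 ≤ m → 1 ≤ n → 1 < gcd (m + 1) (n + 1) → ¬ IntervalColorable (K1 m n)
mainTheorem2 m n 1≤m _ 1<gcd (_ , _ , φ) =
  no-interval-colouring 1≤m 1<gcd (gcd[m,n]∣m (m + 1) (n + 1)) (gcd[m,n]∣n (m + 1) (n + 1)) φ
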